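{- Let $(G,T)$ be a graft admitting a cyclic decomposition. Then $(G,T)$ does not contain a minor isomorphic to $\Delta_1$, $\Delta_2$, or $\Delta_3$.
   Context: Graphs are finite and may have loops and parallel edges. A graft is a pair $(G,T)$ of a graph $G$ and $T\subseteq V(G)$. A cyclic decomposition of $(G,T)$ is a pair $(H,\mathcal{B})$ where $H$ is a bipartite graph (parallel edges allowed) of maximum degree at most $2$ and $\mathcal{B}=\{B_x:x\in V(H)\}$ is a collection of subsets of $V(G)$ such that: (C1) $\bigcup_{x\in V(H)}B_x=V(G)$; (C2) if $u,v$ are adjacent in $G$ then $\{u,v\}\subseteq B_x$ for some $x\in V(H)$; (C3) for distinct $x,y\in V(H)$, $B_x\cap B_y\subseteq T$ and $|B_x\cap B_y|$ equals the number of edges joining $x$ and $y$ in $H$; (C4) $|T\cap B_x|\le 2$ for all $x\in V(H)$. Graft operations: deleting an edge $e$ gives $(G\setminus e,T)$; deleting an isolated vertex $v$ gives $(G\setminus v,T-\{v\})$; contracting an edge $e=uv$ gives $(G/e,T')$ where, with $e^*$ the vertex of $G/e$ formed from the ends of $e$, $T'=(T-\{u,v\})\cup\{e^*\}$ if $|T\cap\{u,v\}|=1$ and $T'=T-\{u,v\}$ otherwise. A minor of a graft is one obtained by a sequence of these operations; grafts are isomorphic if a graph isomorphism maps one distinguished set onto the other. $\Delta_1=(K_3,V(K_3))$, $\Delta_2=(K_{1,3},V(K_{1,3}))$, $\Delta_3=(K_{1,3},S)$ with $S$ the set of degree-$1$ vertices of $K_{1,3}$. -}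

module Defs where

open import Data.Nat using (ℕ; zero; suc; _≤_; _+_)
open import Data.Bool using (Bool; true; false; _∧_; _∨_; _xor_)
open import Data.Fin using (Fin; zero; suc; punchIn; _≟_)
open import Data.Fin.Subset using (Subset; _∈_; _∩_; ∣_∣)
open import Data.Vec using (Vec; lookup; tabulate; []; _∷_)
open import Data.Product using (Σ; ∃; ∃-syntax; _×_; _,_; proj₁; proj₂)
open import Data.Sum using (_⊎_)
open import Relation.Nullary using (¬_)
open import Relation.Nullary.Decidable using (⌊_⌋)
open import Relation.Binary.PropositionalEquality using (_≡_; _≢_)
open import Function.Bundles using (_⤖_; Bijection)

-- Graphs (loops and parallel edges allowed): vertices Fin n, edges Fin m,
-- each edge has an (unordered, stored as a pair) pair of ends.
-- A graft additionally carries T ⊆ V(G) as a Subset.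

record Graft (n m : ℕ) : Set where
  field
    ends : Fin m → Fin n × Fin n
    T    : Subset n
open Graft public

joinCount : ∀ {k l} → (Fin l → Fin k × Fin k) → Fin k → Fin k → ℕ
joinCount hends x y = ∣ tabulate (λ e →
    (⌊ proj₁ (hends e) ≟ x ⌋ ∧ ⌊ proj₂ (hends e) ≟ y ⌋)
  ∨ (⌊ proj₁ (hends e) ≟ y ⌋ ∧ ⌊ proj₂ (hends e) ≟ x ⌋)) ∣

-- degree of x (a loop would count twice)
degree : ∀ {k l} → (Fin l → Fin k × Fin k) → Fin k → ℕ
degree hends x =
    ∣ tabulate (λ e → ⌊ proj₁ (hends e) ≟ x ⌋) ∣
  + ∣ tabulate (λ e → ⌊ proj₂ (hends e) ≟ x ⌋) ∣

record CyclicDecomposition {n m : ℕ} (G : Graft n m) : Set where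
  field
    k l      : ℕ
    hends    : Fin l → Fin k × Fin k
    bip      : Σ (Fin k → Bool) (λ c → ∀ e → c (proj₁ (hends e)) ≢ c (proj₂ (hends e)))
    maxdeg   : ∀ x → degree hends x ≤ 2
    B        : Fin k → Subset n
    C1       : ∀ v → ∃[ x ] (v ∈ B x)
    C2       : ∀ e → ∃[ x ] (proj₁ (ends G e) ∈ B x × proj₂ (ends G e) ∈ B x)
    C3-sub   : ∀ x y → x ≢ y → ∀ v → v ∈ B x → v ∈ B y → v ∈ T G
    C3-card  : ∀ x y → x ≢ y → ∣ B x ∩ B y ∣ ≡ joinCount hends x y
    C4       : ∀ x → ∣ T G ∩ B x ∣ ≤ 2

data Step : ∀ {n m n' m'} → Graft n m → Graft n' m' → Set where
  del-edge : ∀ {n m} (G : Graft n (suc m)) (G' : Graft n m) (e : Fin (suc m)) →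
    (∀ i → ends G' i ≡ ends G (punchIn e i)) →
    T G' ≡ T G →
    Step G G'
  -- delete vertex v, which is isolated: every edge of G avoids v
  -- (G's edges are exactly G''s edges shifted past v); T' = T - {v}
  del-vertex : ∀ {n m} (G : Graft (suc n) m) (G' : Graft n m) (v : Fin (suc n)) →
    (∀ i → ends G i ≡ (punchIn v (proj₁ (ends G' i)) , punchIn v (proj₂ (ends G' i)))) →
    (∀ w → lookup (T G') w ≡ lookup (T G) (punchIn v w)) →
    Step G G'
  -- contract a non-loop edge e = uv: f : V(G) → V(G/e) is a surjection
  -- identifying exactly u and v; e* = f u; edges are the images of the
  -- remaining edges; e* ∈ T' iff exactly one of u, v lies in T.
  contract : ∀ {n m} (G : Graft (suc n) (suc m)) (G' : Graft n m) (e : Fin (suc m))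
    (f : Fin (suc n) → Fin n) →
    let u = proj₁ (ends G e) ; v = proj₂ (ends G e) in
    u ≢ v →
    f u ≡ f v →
    (∀ a b → f a ≡ f b → a ≡ b ⊎ ((a ≡ u × b ≡ v) ⊎ (a ≡ v × b ≡ u))) →
    (∀ w → ∃[ a ] (f a ≡ w)) →
    (∀ i → ends G' i ≡ (f (proj₁ (ends G (punchIn e i))) , f (proj₂ (ends G (punchIn e i))))) →
    (∀ a → a ≢ u → a ≢ v → lookup (T G') (f a) ≡ lookup (T G) a) →
    lookup (T G') (f u) ≡ (lookup (T G) u xor lookup (T G) v) →
    Step G G'
  -- contract a loop e: G/e = G \ e and T' = T (the rule for T' gives T)
  contract-loop : ∀ {n m} (G : Graft n (suc m)) (G' : Graft n m) (e : Fin (suc m)) →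
    proj₁ (ends G e) ≡ proj₂ (ends G e) →
    (∀ i → ends G' i ≡ ends G (punchIn e i)) →
    T G' ≡ T G →
    Step G G'

data Minor : ∀ {n m n' m'} → Graft n m → Graft n' m' → Set where
  here : ∀ {n m} (G : Graft n m) → Minor G G
  next : ∀ {n m n' m' n'' m''} {G : Graft n m} {G' : Graft n' m'} {G'' : Graft n'' m''} →
    Step G G' → Minor G' G'' → Minor G G''

SameEdge : ∀ {n} → Fin n × Fin n → Fin n × Fin n → Set
SameEdge (a , b) (c , d) = (a ≡ c × b ≡ d) ⊎ (a ≡ d × b ≡ c)

record Iso {n m n' m'} (G : Graft n m) (G' : Graft n' m') : Set where
  field
    φ : Fin n ⤖ Fin n'
    ψ : Fin m ⤖ Fin m'
    edges-ok : ∀ e → SameEdge (ends G' (Bijection.to ψ e))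
                              (Bijection.to φ (proj₁ (ends G e)) , Bijection.to φ (proj₂ (ends G e)))
    T-ok : ∀ v → lookup (T G') (Bijection.to φ v) ≡ lookup (T G) v

HasMinorIsoTo : ∀ {n m n' m'} → Graft n m → Graft n' m' → Set
HasMinorIsoTo {n} {m} G Δ =
  Σ ℕ λ n'' → Σ ℕ λ m'' → Σ (Graft n'' m'') λ H → Minor G H × Iso H Δ

Δ₁ : Graft 3 3
Δ₁ = record { ends = K3 ; T = true ∷ true ∷ true ∷ [] }
  where
  K3 : Fin 3 → Fin 3 × Fin 3
  K3 zero = zero , suc zero
  K3 (suc zero) = suc zero , suc (suc zero)
  K3 (suc (suc zero)) = zero , suc (suc zero)

K13 : Fin 3 → Fin 4 × Fin 4
K13 e = zero , suc e

Δ₂ : Graft 4 3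
Δ₂ = record { ends = K13 ; T = true ∷ true ∷ true ∷ true ∷ [] }

Δ₃ : Graft 4 3
Δ₃ = record { ends = K13 ; T = false ∷ true ∷ true ∷ true ∷ [] }

-- Forget from a cyclic decomposition everything but a cover of the edges by
-- bags that pairwise meet only in T, contain at most two T-vertices each, and
-- are 2-coloured (by the bipartition of H) so that meeting bags differ in
-- colour.  Such covers survive deleting edges and isolated vertices and
-- isomorphisms.  They also survive contracting an edge uv: if v ∉ T, then v
-- lies only in the bag of uv and u can stand in for the new vertex; if
-- u, v ∈ T, the new vertex is outside T, and all bags through u or v are merged
-- into the bag x of uv, which switches colour, because every other bag meeting
-- the merged ones meets one of them in a T-vertex and so has the colour of x.
-- None of Δ₁, Δ₂, Δ₃ has such a cover: no bag holds three T-vertices, and three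
-- pairwise meeting bags would need three colours (for Δ₃ the centre, being
-- outside T, lies in a single bag).

module Submission where

open import Defs
open import Data.Nat using (ℕ; _≤_; z≤n; s≤s)
open import Data.Nat.Properties using (≤-trans; 1+n≰n)
open import Data.Bool using (Bool; true; false; not; _∧_; _∨_; _xor_; if_then_else_) renaming (T to IsTrue)
open import Data.Bool.Properties
  using (¬-not; not-¬; not-injective; xor-comm; xor-identityʳ; T-≡; T-∧; T-∨)
open import Data.Fin using (Fin; zero; suc; punchIn; _≟_)
open import Data.Fin.Properties using (any?; punchIn-injective)
open import Data.Fin.Subset using (Subset; _∈_; _∩_; ∣_∣; Nonempty)
open import Data.Fin.Subset.Properties
  using (_∈?_; x∈p∩q⁺; x∈p⇒∣p-x∣<∣p∣; x∈p∧x≢y⇒x∈p-y; nonempty?; Empty-unique; ∣⊥∣≡0)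
open import Data.Vec using (lookup; tabulate)
open import Data.Vec.Properties using ([]=⇒lookup; lookup⇒[]=; lookup∘tabulate)
open import Data.Product using (∃-syntax; _×_; _,_; proj₁; proj₂; map)
open import Data.Sum using (_⊎_; inj₁; inj₂)
open import Data.Empty using (⊥; ⊥-elim)
open import Function using (id)
open import Function.Bundles using (Bijection; module Equivalence; module Surjection)
open import Function.Definitions using (Injective)
open import Relation.Nullary using (¬_; Dec; yes; no; does)
open import Relation.Nullary.Decidable using (⌊_⌋; _×-dec_; _⊎-dec_; ¬?; toWitness; dec-true; dec-false)
open import Relation.Binary.PropositionalEquality
  using (_≡_; _≢_; refl; sym; trans; cong; cong₂; subst; subst₂)

InT : ∀ {n m} → Graft n m → Fin n → Set
InT G a = lookup (T G) a ≡ true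

false⇒¬InT : ∀ {n m} {G : Graft n m} {a} → lookup (T G) a ≡ false → ¬ InT G a
false⇒¬InT a∉T a∈T with trans (sym a∈T) a∉T
... | ()

Distinct₃ : ∀ {A : Set} → A → A → A → Set
Distinct₃ a b c = a ≢ b × a ≢ c × b ≢ c

Distinct₃-map : ∀ {A B : Set} {g : A → B} → Injective _≡_ _≡_ g →
  ∀ {a b c} → Distinct₃ a b c → Distinct₃ (g a) (g b) (g c)
Distinct₃-map g-inj (a≢b , a≢c , b≢c) =
  (λ eq → a≢b (g-inj eq)) , (λ eq → a≢c (g-inj eq)) , (λ eq → b≢c (g-inj eq))

Distinct₃-unmap : ∀ {A B : Set} (g : A → B) {a b c} →
  Distinct₃ (g a) (g b) (g c) → Distinct₃ a b c
Distinct₃-unmap g (a≢b , a≢c , b≢c) =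
  (λ eq → a≢b (cong g eq)) , (λ eq → a≢c (cong g eq)) , (λ eq → b≢c (cong g eq))

¬Distinct₃-Bool : ∀ {a b c : Bool} → ¬ Distinct₃ a b c
¬Distinct₃-Bool (a≢b , a≢c , b≢c) = b≢c (not-injective (trans (sym (¬-not a≢b)) (¬-not a≢c)))

InOneBag : ∀ {k n} → (Fin k → Fin n → Set) → Fin n × Fin n → Set
InOneBag Bag e = ∃[ x ] (Bag x (proj₁ e) × Bag x (proj₂ e))

InOneBag-SameEdge : ∀ {k n} {Bag : Fin k → Fin n → Set} {a b a' b'} →
  SameEdge (a , b) (a' , b') → InOneBag Bag (a' , b') → InOneBag Bag (a , b)
InOneBag-SameEdge (inj₁ (refl , refl)) h               = h
InOneBag-SameEdge (inj₂ (refl , refl)) (x , x∋a , x∋b) = x , x∋b , x∋a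

SameEdge-map : ∀ {n n'} (g : Fin n → Fin n') {e e' : Fin n × Fin n} →
  SameEdge e e' → SameEdge (map g g e) (map g g e')
SameEdge-map g (inj₁ (p , q)) = inj₁ (cong g p , cong g q)
SameEdge-map g (inj₂ (p , q)) = inj₂ (cong g p , cong g q)

record Cover {n m} (G : Graft n m) : Set₁ where
  field
    k              : ℕ
    Bag            : Fin k → Fin n → Set
    bag?           : ∀ x a → Dec (Bag x a)
    colour         : Fin k → Bool
    covers         : ∀ e → InOneBag Bag (ends G e)
    shared⇒T       : ∀ {x y a} → x ≢ y → Bag x a → Bag y a → InT G a
    shared⇒colour≢ : ∀ {x y a} → x ≢ y → Bag x a → Bag y a → colour x ≢ colour y
    ≤2-T           : ∀ {x a b c} → Distinct₃ a b c → Bag x a → Bag x b → Bag x c →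
                     InT G a → InT G b → InT G c → ⊥

module _ {n m} {G : Graft n m} (c : Cover G) where
  open Cover c

  no-bag-triangle : ∀ {x y z a b d} → Distinct₃ x y z →
    Bag x a → Bag y a → Bag y b → Bag z b → Bag z d → Bag x d → ⊥
  no-bag-triangle (x≢y , x≢z , y≢z) x∋a y∋a y∋b z∋b z∋d x∋d =
    ¬Distinct₃-Bool ( shared⇒colour≢ x≢y x∋a y∋a
                    , shared⇒colour≢ x≢z x∋d z∋d
                    , shared⇒colour≢ y≢z y∋b z∋b )

  non-T⇒one-bag : ∀ {x y a} → ¬ InT G a → Bag x a → Bag y a → x ≡ y
  non-T⇒one-bag {x} {y} a∉T x∋a y∋a with x ≟ y
  ... | yes x≡y = x≡y
  ... | no x≢y  = ⊥-elim (a∉T (shared⇒T x≢y x∋a y∋a))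

∈⇒1≤∣p∣ : ∀ {n} {p : Subset n} {a} → a ∈ p → 1 ≤ ∣ p ∣
∈⇒1≤∣p∣ a∈p = ≤-trans (s≤s z≤n) (x∈p⇒∣p-x∣<∣p∣ a∈p)

1≤∣p∣⇒Nonempty : ∀ {n} (p : Subset n) → 1 ≤ ∣ p ∣ → Nonempty p
1≤∣p∣⇒Nonempty {n} p 1≤∣p∣ with nonempty? p
... | yes ne = ne
... | no  ∅  =
  ⊥-elim (1+n≰n (subst (1 ≤_) (trans (cong ∣_∣ (Empty-unique ∅)) (∣⊥∣≡0 n)) 1≤∣p∣))

∈³⇒3≤∣p∣ : ∀ {n} {p : Subset n} {a b c} → Distinct₃ a b c →
  a ∈ p → b ∈ p → c ∈ p → 3 ≤ ∣ p ∣
∈³⇒3≤∣p∣ (a≢b , a≢c , b≢c) a∈p b∈p c∈p =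
  ≤-trans (s≤s (s≤s (∈⇒1≤∣p∣ c∈p-a-b)))
          (≤-trans (s≤s (x∈p⇒∣p-x∣<∣p∣ b∈p-a)) (x∈p⇒∣p-x∣<∣p∣ a∈p))
  where
  b∈p-a   = x∈p∧x≢y⇒x∈p-y b∈p (λ eq → a≢b (sym eq))
  c∈p-a-b = x∈p∧x≢y⇒x∈p-y (x∈p∧x≢y⇒x∈p-y c∈p (λ eq → a≢c (sym eq)))
                           (λ eq → b≢c (sym eq))

joined⇒SameEdge : ∀ {k} (p q x y : Fin k) →
  IsTrue ((⌊ p ≟ x ⌋ ∧ ⌊ q ≟ y ⌋) ∨ (⌊ p ≟ y ⌋ ∧ ⌊ q ≟ x ⌋)) →
  SameEdge (p , q) (x , y)
joined⇒SameEdge p q x y h with Equivalence.to T-∨ h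
... | inj₁ h' = inj₁ (map (toWitness {a? = p ≟ x}) (toWitness {a? = q ≟ y}) (Equivalence.to T-∧ h'))
... | inj₂ h' = inj₂ (map (toWitness {a? = p ≟ y}) (toWitness {a? = q ≟ x}) (Equivalence.to T-∧ h'))

proper-colouring-SameEdge : ∀ {k} (col : Fin k → Bool) {p q x y : Fin k} →
  col p ≢ col q → SameEdge (p , q) (x , y) → col x ≢ col y
proper-colouring-SameEdge col cp≢cq (inj₁ (refl , refl)) = cp≢cq
proper-colouring-SameEdge col cp≢cq (inj₂ (refl , refl)) = λ eq → cp≢cq (sym eq)

decomposition⇒cover : ∀ {n m} {G : Graft n m} → CyclicDecomposition G → Cover G
decomposition⇒cover {G = G} cd = record
  { k              = k
  ; Bag            = λ x a → a ∈ B x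
  ; bag?           = λ x a → a ∈? B x
  ; colour         = proj₁ bip
  ; covers         = C2
  ; shared⇒T       = λ x≢y x∋a y∋a → []=⇒lookup (C3-sub _ _ x≢y _ x∋a y∋a)
  ; shared⇒colour≢ = shared⇒colour≢
  ; ≤2-T           = ≤2-T
  }
  where
  open CyclicDecomposition cd

  joins : Fin k → Fin k → Fin l → Bool
  joins x y e = (⌊ proj₁ (hends e) ≟ x ⌋ ∧ ⌊ proj₂ (hends e) ≟ y ⌋)
              ∨ (⌊ proj₁ (hends e) ≟ y ⌋ ∧ ⌊ proj₂ (hends e) ≟ x ⌋)

  shared⇒colour≢ : ∀ {x y a} → x ≢ y → a ∈ B x → a ∈ B y → proj₁ bip x ≢ proj₁ bip y
  shared⇒colour≢ {x} {y} x≢y x∋a y∋a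
    with 1≤∣p∣⇒Nonempty (tabulate (joins x y))
           (subst (1 ≤_) (C3-card x y x≢y) (∈⇒1≤∣p∣ (x∈p∩q⁺ (x∋a , y∋a))))
  ... | e , e-joins =
    proper-colouring-SameEdge (proj₁ bip) (proj₂ bip e)
      (joined⇒SameEdge (proj₁ (hends e)) (proj₂ (hends e)) x y
        (Equivalence.from T-≡ (trans (sym (lookup∘tabulate (joins x y) e)) ([]=⇒lookup e-joins))))

  ≤2-T : ∀ {x a b c} → Distinct₃ a b c → a ∈ B x → b ∈ B x → c ∈ B x →
         InT G a → InT G b → InT G c → ⊥
  ≤2-T {x} d a∈x b∈x c∈x a∈T b∈T c∈T with
    ≤-trans (∈³⇒3≤∣p∣ d (in-T∩B a∈T a∈x) (in-T∩B b∈T b∈x) (in-T∩B c∈T c∈x)) (C4 x)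
    where in-T∩B : ∀ {a} → InT G a → a ∈ B x → a ∈ T G ∩ B x
          in-T∩B {a} a∈T a∈x = x∈p∩q⁺ (lookup⇒[]= a _ a∈T , a∈x)
  ... | s≤s (s≤s ())

Δ₁-uncoverable : ¬ Cover Δ₁
Δ₁-uncoverable c with Cover.covers c zero | Cover.covers c (suc zero) | Cover.covers c (suc (suc zero))
... | x , x∋0 , x∋1 | y , y∋1 , y∋2 | z , z∋0 , z∋2 with x ≟ y | x ≟ z | y ≟ z
...   | yes refl | _        | _        =
  Cover.≤2-T c ((λ ()) , (λ ()) , (λ ())) x∋0 x∋1 y∋2 refl refl refl
...   | no _     | yes refl | _        =
  Cover.≤2-T c ((λ ()) , (λ ()) , (λ ())) x∋0 x∋1 z∋2 refl refl refl
...   | no _     | no _     | yes refl =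
  Cover.≤2-T c ((λ ()) , (λ ()) , (λ ())) z∋0 y∋1 y∋2 refl refl refl
...   | no x≢y   | no x≢z   | no y≢z   =
  no-bag-triangle c (x≢y , x≢z , y≢z) x∋1 y∋1 y∋2 z∋2 z∋0 x∋0

Δ₂-uncoverable : ¬ Cover Δ₂
Δ₂-uncoverable c with Cover.covers c zero | Cover.covers c (suc zero) | Cover.covers c (suc (suc zero))
... | x , x∋0 , x∋1 | y , y∋0 , y∋2 | z , z∋0 , z∋3 with x ≟ y | x ≟ z | y ≟ z
...   | yes refl | _        | _        =
  Cover.≤2-T c ((λ ()) , (λ ()) , (λ ())) x∋0 x∋1 y∋2 refl refl refl
...   | no _     | yes refl | _        =
  Cover.≤2-T c ((λ ()) , (λ ()) , (λ ())) x∋0 x∋1 z∋3 refl refl refl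
...   | no _     | no _     | yes refl =
  Cover.≤2-T c ((λ ()) , (λ ()) , (λ ())) y∋0 y∋2 z∋3 refl refl refl
...   | no x≢y   | no x≢z   | no y≢z   =
  no-bag-triangle c (x≢y , x≢z , y≢z) x∋0 y∋0 y∋0 z∋0 z∋0 x∋0

Δ₃-uncoverable : ¬ Cover Δ₃
Δ₃-uncoverable c with Cover.covers c zero | Cover.covers c (suc zero) | Cover.covers c (suc (suc zero))
... | x , x∋0 , x∋1 | y , y∋0 , y∋2 | z , z∋0 , z∋3
  with non-T⇒one-bag c (λ ()) x∋0 y∋0 | non-T⇒one-bag c (λ ()) x∋0 z∋0
...   | refl | refl =
  Cover.≤2-T c ((λ ()) , (λ ()) , (λ ())) x∋1 y∋2 z∋3 refl refl refl

-- Pullbacks: deletions and isomorphisms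

pullback : ∀ {n m n' m'} {G : Graft n m} {G' : Graft n' m'} (c : Cover G)
  (g : Fin n' → Fin n) → Injective _≡_ _≡_ g →
  (∀ a → lookup (T G') a ≡ lookup (T G) (g a)) →
  (∀ i → InOneBag (Cover.Bag c) (map g g (ends G' i))) →
  Cover G'
pullback c g g-inj T-pullback covered = record
  { k              = k
  ; Bag            = λ x a → Bag x (g a)
  ; bag?           = λ x a → bag? x (g a)
  ; colour         = colour
  ; covers         = covered
  ; shared⇒T       = λ x≢y x∋a y∋a → trans (T-pullback _) (shared⇒T x≢y x∋a y∋a)
  ; shared⇒colour≢ = shared⇒colour≢
  ; ≤2-T           = λ d x∋a x∋b x∋c a∈T b∈T c∈T →
      ≤2-T (Distinct₃-map g-inj d) x∋a x∋b x∋c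
        (trans (sym (T-pullback _)) a∈T) (trans (sym (T-pullback _)) b∈T) (trans (sym (T-pullback _)) c∈T)
  }
  where open Cover c

cover-spanning-subgraph : ∀ {n m m'} {G : Graft n m} {G' : Graft n m'} (h : Fin m' → Fin m) →
  (∀ i → ends G' i ≡ ends G (h i)) → T G' ≡ T G → Cover G → Cover G'
cover-spanning-subgraph h ends≡ T≡ c =
  pullback c id id (λ a → cong (λ t → lookup t a) T≡)
    (λ i → subst (InOneBag (Cover.Bag c)) (sym (ends≡ i)) (Cover.covers c (h i)))

cover-iso : ∀ {n m n' m'} {G : Graft n m} {G' : Graft n' m'} → Iso G G' → Cover G → Cover G'
cover-iso {G = G} {G'} iso c =
  pullback c from from-injective T-from covered
  where
  open Iso iso
  to   = Bijection.to φ
  from = Bijection.to⁻ φ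

  to∘from : ∀ a → to (from a) ≡ a
  to∘from = Surjection.to∘to⁻ (Bijection.surjection φ)

  from∘to : ∀ a → from (to a) ≡ a
  from∘to a = Bijection.injective φ (to∘from (to a))

  from-injective : Injective _≡_ _≡_ from
  from-injective {a} {b} eq = trans (sym (to∘from a)) (trans (cong to eq) (to∘from b))

  T-from : ∀ a → lookup (T G') a ≡ lookup (T G) (from a)
  T-from a = trans (cong (lookup (T G')) (sym (to∘from a))) (T-ok (from a))

  covered : ∀ d → InOneBag (Cover.Bag c) (map from from (ends G' d))
  covered d = InOneBag-SameEdge {Bag = Cover.Bag c} (SameEdge-map from same)
    (subst₂ (λ a b → InOneBag (Cover.Bag c) (a , b)) (sym (from∘to _)) (sym (from∘to _))
      (Cover.covers c j))
    where
    j    = Bijection.to⁻ ψ d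
    same = subst (λ i → SameEdge (ends G' i) (map to to (ends G j)))
                 (Surjection.to∘to⁻ (Bijection.surjection ψ) d) (edges-ok j)

-- Contractions

record Contraction {n m n' m'} (G : Graft n m) (G' : Graft n' m') (u v : Fin n) : Set where
  field
    f             : Fin n → Fin n'
    merges        : f u ≡ f v
    injective-off : ∀ {a b} → a ≢ u → a ≢ v → f b ≡ f a → b ≡ a
    surjective    : ∀ b → ∃[ a ] (f a ≡ b)
    old-edge      : Fin m' → Fin m
    ends-image    : ∀ i → ends G' i ≡ map f f (ends G (old-edge i))
    T-off         : ∀ a → a ≢ u → a ≢ v → lookup (T G') (f a) ≡ lookup (T G) a
    T-merged      : lookup (T G') (f u) ≡ lookup (T G) u xor lookup (T G) v

Contraction-swap : ∀ {n m n' m'} {G : Graft n m} {G' : Graft n' m'} {u v} →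
  Contraction G G' u v → Contraction G G' v u
Contraction-swap {G = G} {G'} {u} {v} κ = record
  { f             = f
  ; merges        = sym merges
  ; injective-off = λ a≢v a≢u → injective-off a≢u a≢v
  ; surjective    = surjective
  ; old-edge      = old-edge
  ; ends-image    = ends-image
  ; T-off         = λ a a≢v a≢u → T-off a a≢u a≢v
  ; T-merged      = trans (cong (lookup (T G')) (sym merges))
                          (trans T-merged (xor-comm (lookup (T G) u) (lookup (T G) v)))
  }
  where open Contraction κ

module ContractNonTEnd
  {n m n' m'} {G : Graft n m} {G' : Graft n' m'} (c : Cover G)
  {r w : Fin n} (κ : Contraction G G' r w) (w∉T : lookup (T G) w ≡ false)
  {x : Fin (Cover.k c)} (x∋r : Cover.Bag c x r) (x∋w : Cover.Bag c x w) where

  open Cover c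
  open Contraction κ

  σ : Fin n' → Fin n
  σ b with b ≟ f r
  ... | yes _ = r
  ... | no  _ = proj₁ (surjective b)

  f∘σ : ∀ b → f (σ b) ≡ b
  f∘σ b with b ≟ f r
  ... | yes b≡fr = sym b≡fr
  ... | no  _    = proj₂ (surjective b)

  σ-injective : Injective _≡_ _≡_ σ
  σ-injective {a} {b} eq = trans (sym (f∘σ a)) (trans (cong f eq) (f∘σ b))

  σ∘f-off : ∀ {a} → a ≢ r → a ≢ w → σ (f a) ≡ a
  σ∘f-off a≢r a≢w = injective-off a≢r a≢w (f∘σ _)

  σ∘f-r : σ (f r) ≡ r
  σ∘f-r with f r ≟ f r
  ... | yes _   = refl
  ... | no  ≢fr = ⊥-elim (≢fr refl)

  T-σ : ∀ b → lookup (T G') b ≡ lookup (T G) (σ b)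
  T-σ b with b ≟ f r
  ... | yes refl = trans T-merged (trans (cong (lookup (T G) r xor_) w∉T) (xor-identityʳ _))
  ... | no  b≢fr = trans (cong (lookup (T G')) (sym fa≡b)) (T-off a a≢r a≢w)
    where
    a    = proj₁ (surjective b)
    fa≡b = proj₂ (surjective b)
    a≢r : a ≢ r
    a≢r a≡r = b≢fr (trans (sym fa≡b) (cong f a≡r))
    a≢w : a ≢ w
    a≢w a≡w = b≢fr (trans (sym fa≡b) (trans (cong f a≡w) (sym merges)))

  Bag-σ∘f : ∀ {y a} → Bag y a → Bag y (σ (f a))
  Bag-σ∘f {y} {a} y∋a with a ≟ r | a ≟ w
  ... | yes refl | _        = subst (Bag y) (sym σ∘f-r) y∋a
  ... | no  _    | yes refl rewrite non-T⇒one-bag c (false⇒¬InT {G = G} w∉T) y∋a x∋w =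
    subst (Bag x) (sym (trans (cong σ (sym merges)) σ∘f-r)) x∋r
  ... | no  a≢r  | no  a≢w  = subst (Bag y) (sym (σ∘f-off a≢r a≢w)) y∋a

  cover : Cover G'
  cover = pullback c σ σ-injective T-σ covered
    where
    covered : ∀ i → InOneBag Bag (map σ σ (ends G' i))
    covered i with covers (old-edge i)
    ... | y , y∋p , y∋q =
      subst (λ e → InOneBag Bag (map σ σ e)) (sym (ends-image i)) (y , Bag-σ∘f y∋p , Bag-σ∘f y∋q)

module ContractTEdge
  {n m n' m'} {G : Graft n m} {G' : Graft n' m'} (c : Cover G)
  {u v : Fin n} (κ : Contraction G G' u v) (u≢v : u ≢ v) (u∈T : InT G u) (v∈T : InT G v)
  {x : Fin (Cover.k c)} (x∋u : Cover.Bag c x u) (x∋v : Cover.Bag c x v) where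

  open Cover c
  open Contraction κ

  S : Fin k → Set
  S s = Bag s u ⊎ Bag s v

  S? : ∀ s → Dec (S s)
  S? s = bag? s u ⊎-dec bag? s v

  OtherT : Fin n → Set
  OtherT a = InT G a × a ≢ u × a ≢ v

  OffEdgeT : Fin k → Fin n → Set
  OffEdgeT s a = Bag s a × OtherT a

  OffEdgeT⇒≢x : ∀ {s a} → OffEdgeT s a → s ≢ x
  OffEdgeT⇒≢x (x∋a , a∈T , a≢u , a≢v) refl = ≤2-T (a≢u , a≢v , u≢v) x∋a x∋u x∋v a∈T u∈T v∈T

  S⇒colour≢x : ∀ {s} → S s → s ≢ x → colour s ≢ colour x
  S⇒colour≢x (inj₁ s∋u) s≢x = shared⇒colour≢ s≢x s∋u x∋u
  S⇒colour≢x (inj₂ s∋v) s≢x = shared⇒colour≢ s≢x s∋v x∋v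

  ∉S⇒≢x : ∀ {y} → ¬ S y → y ≢ x
  ∉S⇒≢x y∉S refl = y∉S (inj₁ x∋u)

  ∉S⇒off-edge : ∀ {y a} → ¬ S y → Bag y a → a ≢ u × a ≢ v
  ∉S⇒off-edge y∉S y∋a = (λ { refl → y∉S (inj₁ y∋a) }) , (λ { refl → y∉S (inj₂ y∋a) })

  crossing : ∀ {s z a} → S s → ¬ S z → Bag s a → Bag z a → InT G a × colour z ≡ colour x
  crossing {s} {z} s∈S z∉S s∋a z∋a =
    a∈T , trans (¬-not (shared⇒colour≢ z≢s z∋a s∋a))
                (sym (¬-not (λ eq → S⇒colour≢x s∈S s≢x (sym eq))))
    where
    z≢s : z ≢ s
    z≢s refl = z∉S s∈S
    a∈T = shared⇒T (λ eq → z≢s (sym eq)) s∋a z∋a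
    s≢x = OffEdgeT⇒≢x (s∋a , a∈T , ∉S⇒off-edge z∉S z∋a)

  -- The bags of S other than x become empty.
  Merged : Fin k → Fin n → Set
  Merged y a = (y ≡ x × ∃[ s ] (S s × Bag s a)) ⊎ (¬ S y × Bag y a)

  Merged? : ∀ y a → Dec (Merged y a)
  Merged? y a = (y ≟ x ×-dec any? (λ s → S? s ×-dec bag? s a)) ⊎-dec (¬? (S? y) ×-dec bag? y a)

  Merged-in-S : ∀ {y a} → S y → Merged y a → ∃[ s ] (S s × Bag s a)
  Merged-in-S y∈S (inj₁ (_ , s∋a)) = s∋a
  Merged-in-S y∈S (inj₂ (y∉S , _)) = ⊥-elim (y∉S y∈S)

  Merged-outside-S : ∀ {y a} → ¬ S y → Merged y a → Bag y a
  Merged-outside-S y∉S (inj₁ (refl , _)) = ⊥-elim (y∉S (inj₁ x∋u))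
  Merged-outside-S y∉S (inj₂ (_ , y∋a))  = y∋a

  colour' : Fin k → Bool
  colour' y = if does (y ≟ x) then not (colour x) else colour y

  colour'-x : colour' x ≡ not (colour x)
  colour'-x = cong (λ b → if b then not (colour x) else colour x) (dec-true (x ≟ x) refl)

  colour'-≢x : ∀ {y} → y ≢ x → colour' y ≡ colour y
  colour'-≢x {y} y≢x = cong (λ b → if b then not (colour x) else colour y) (dec-false (y ≟ x) y≢x)

  merged-vs-outside : ∀ {s z a} → S s → Bag s a → ¬ S z → Bag z a →
    InT G a × colour' x ≢ colour' z
  merged-vs-outside s∈S s∋a z∉S z∋a
    with a∈T , cz≡cx ← crossing s∈S z∉S s∋a z∋a
    rewrite colour'-x | colour'-≢x (∉S⇒≢x z∉S) = a∈T , λ eq → not-¬ cz≡cx (sym eq)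

  Merged-shared : ∀ {y z a} → y ≢ z → Merged y a → Merged z a → InT G a × colour' y ≢ colour' z
  Merged-shared y≢z (inj₁ (refl , _)) (inj₁ (refl , _)) = ⊥-elim (y≢z refl)
  Merged-shared _ (inj₁ (refl , s , s∈S , s∋a)) (inj₂ (z∉S , z∋a)) =
    merged-vs-outside s∈S s∋a z∉S z∋a
  Merged-shared _ (inj₂ (y∉S , y∋a)) (inj₁ (refl , s , s∈S , s∋a))
    with a∈T , cx≢cy ← merged-vs-outside s∈S s∋a y∉S y∋a = a∈T , λ eq → cx≢cy (sym eq)
  Merged-shared {y} {z} y≢z (inj₂ (y∉S , y∋a)) (inj₂ (z∉S , z∋a))
    rewrite colour'-≢x (∉S⇒≢x y∉S) | colour'-≢x (∉S⇒≢x z∉S) =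
    shared⇒T y≢z y∋a z∋a , shared⇒colour≢ y≢z y∋a z∋a

  Bag' : Fin k → Fin n' → Set
  Bag' y b = ∃[ a ] (Merged y a × f a ≡ b)

  Merged-covers : ∀ {y a b} → Bag y a → Bag y b → InOneBag Merged (a , b)
  Merged-covers {y} y∋a y∋b with S? y
  ... | yes y∈S = x , inj₁ (refl , y , y∈S , y∋a) , inj₁ (refl , y , y∈S , y∋b)
  ... | no  y∉S = y , inj₂ (y∉S , y∋a) , inj₂ (y∉S , y∋b)

  image-covers : ∀ {e} → InOneBag Merged e → InOneBag Bag' (map f f e)
  image-covers (y , y∋a , y∋b) = y , (_ , y∋a , refl) , (_ , y∋b , refl)

  Merged-fibre : ∀ {y a a'} → a ≢ u → a ≢ v → f a' ≡ f a → Merged y a' → Merged y a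
  Merged-fibre {y} a≢u a≢v fa'≡fa = subst (Merged y) (injective-off a≢u a≢v fa'≡fa)

  common-preimage : ∀ {y z b} → y ≢ z → Bag' y b → Bag' z b →
    ∃[ a ] (Merged y a × Merged z a × (a ≢ u × a ≢ v) × f a ≡ b)
  common-preimage y≢z (_ , inj₁ (refl , _) , _) (_ , inj₁ (refl , _) , _) = ⊥-elim (y≢z refl)
  common-preimage _ (a , y∋a , fa≡b) (a' , z∋a'@(inj₂ (z∉S , z∋a'₀)) , fa'≡b) =
    a' , Merged-fibre a'≢u a'≢v (trans fa≡b (sym fa'≡b)) y∋a , z∋a' , (a'≢u , a'≢v) , fa'≡b
    where a'≢u = proj₁ (∉S⇒off-edge z∉S z∋a'₀)
          a'≢v = proj₂ (∉S⇒off-edge z∉S z∋a'₀)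
  common-preimage _ (a , y∋a@(inj₂ (y∉S , y∋a₀)) , fa≡b) (a' , z∋a' , fa'≡b) =
    a , y∋a , Merged-fibre a≢u a≢v (trans fa'≡b (sym fa≡b)) z∋a' , (a≢u , a≢v) , fa≡b
    where a≢u = proj₁ (∉S⇒off-edge y∉S y∋a₀)
          a≢v = proj₂ (∉S⇒off-edge y∉S y∋a₀)

  fu∉T : ¬ InT G' (f u)
  fu∉T = false⇒¬InT {G = G'} (trans T-merged (cong₂ _xor_ u∈T v∈T))

  lift-T : ∀ {y b} → Bag' y b → InT G' b → ∃[ a ] ((Merged y a × OtherT a) × f a ≡ b)
  lift-T (a , y∋a , refl) fa∈T =
    a , (y∋a , trans (sym (T-off a a≢u a≢v)) fa∈T , a≢u , a≢v) , refl
    where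
    a≢u : a ≢ u
    a≢u refl = fu∉T fa∈T
    a≢v : a ≢ v
    a≢v refl = fu∉T (subst (InT G') (sym merges) fa∈T)

  SameEnd : Fin k → Fin k → Set
  SameEnd s s' = (Bag s u × Bag s' u) ⊎ (Bag s v × Bag s' v)

  same-end-pigeonhole : ∀ {s₁ s₂ s₃} → S s₁ → S s₂ → S s₃ →
    SameEnd s₁ s₂ ⊎ SameEnd s₁ s₃ ⊎ SameEnd s₂ s₃
  same-end-pigeonhole (inj₁ p) (inj₁ q) _        = inj₁ (inj₁ (p , q))
  same-end-pigeonhole (inj₂ p) (inj₂ q) _        = inj₁ (inj₂ (p , q))
  same-end-pigeonhole (inj₁ p) (inj₂ _) (inj₁ r) = inj₂ (inj₁ (inj₁ (p , r)))
  same-end-pigeonhole (inj₂ p) (inj₁ _) (inj₂ r) = inj₂ (inj₁ (inj₂ (p , r)))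
  same-end-pigeonhole (inj₁ _) (inj₂ q) (inj₂ r) = inj₂ (inj₂ (inj₂ (q , r)))
  same-end-pigeonhole (inj₂ _) (inj₁ q) (inj₁ r) = inj₂ (inj₂ (inj₁ (q , r)))

  through-end : ∀ {e s s' a a'} → Bag x e → InT G e → Bag s e → Bag s' e →
    OffEdgeT s a → OffEdgeT s' a' → a ≢ e → a' ≢ e → a ≢ a' → ⊥
  through-end {s = s} {s'} x∋e e∈T s∋e s'∋e
              oa@(s∋a , a∈T , _) oa'@(s'∋a' , a'∈T , _) a≢e a'≢e a≢a'
    with s ≟ s'
  ... | yes refl = ≤2-T (a≢a' , a≢e , a'≢e) s∋a s'∋a' s∋e a∈T a'∈T e∈T
  ... | no  s≢s' =
    no-bag-triangle c (s≢s' , OffEdgeT⇒≢x oa , OffEdgeT⇒≢x oa') s∋e s'∋e s'∋e x∋e x∋e s∋e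

  same-end-impossible : ∀ {s s' a a'} → SameEnd s s' → OffEdgeT s a → OffEdgeT s' a' → a ≢ a' → ⊥
  same-end-impossible (inj₁ (s∋u , s'∋u)) oa@(_ , _ , a≢u , _) oa'@(_ , _ , a'≢u , _) =
    through-end x∋u u∈T s∋u s'∋u oa oa' a≢u a'≢u
  same-end-impossible (inj₂ (s∋v , s'∋v)) oa@(_ , _ , _ , a≢v) oa'@(_ , _ , _ , a'≢v) =
    through-end x∋v v∈T s∋v s'∋v oa oa' a≢v a'≢v

  merged-≤2-T : ∀ {s₁ s₂ s₃ a₁ a₂ a₃} → Distinct₃ a₁ a₂ a₃ →
    S s₁ → OffEdgeT s₁ a₁ → S s₂ → OffEdgeT s₂ a₂ → S s₃ → OffEdgeT s₃ a₃ → ⊥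
  merged-≤2-T (a₁≢a₂ , a₁≢a₃ , a₂≢a₃) s₁∈S o₁ s₂∈S o₂ s₃∈S o₃
    with same-end-pigeonhole s₁∈S s₂∈S s₃∈S
  ... | inj₁ e₁₂        = same-end-impossible e₁₂ o₁ o₂ a₁≢a₂
  ... | inj₂ (inj₁ e₁₃) = same-end-impossible e₁₃ o₁ o₃ a₁≢a₃
  ... | inj₂ (inj₂ e₂₃) = same-end-impossible e₂₃ o₂ o₃ a₂≢a₃

  Merged-≤2-T : ∀ {y a₁ a₂ a₃} → Distinct₃ a₁ a₂ a₃ →
    Merged y a₁ × OtherT a₁ → Merged y a₂ × OtherT a₂ → Merged y a₃ × OtherT a₃ → ⊥
  Merged-≤2-T {y} d (p₁ , t₁) (p₂ , t₂) (p₃ , t₃) with S? y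
  ... | yes y∈S with Merged-in-S y∈S p₁ | Merged-in-S y∈S p₂ | Merged-in-S y∈S p₃
  ...   | _ , s₁∈S , s₁∋a₁ | _ , s₂∈S , s₂∋a₂ | _ , s₃∈S , s₃∋a₃ =
    merged-≤2-T d s₁∈S (s₁∋a₁ , t₁) s₂∈S (s₂∋a₂ , t₂) s₃∈S (s₃∋a₃ , t₃)
  Merged-≤2-T d (p₁ , t₁) (p₂ , t₂) (p₃ , t₃) | no y∉S =
    ≤2-T d (Merged-outside-S y∉S p₁) (Merged-outside-S y∉S p₂) (Merged-outside-S y∉S p₃)
      (proj₁ t₁) (proj₁ t₂) (proj₁ t₃)

  cover : Cover G'
  cover = record
    { k              = k
    ; Bag            = Bag'
    ; bag?           = λ y b → any? (λ a → Merged? y a ×-dec (f a ≟ b))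
    ; colour         = colour'
    ; covers         = covers'
    ; shared⇒T       = shared⇒T'
    ; shared⇒colour≢ = shared⇒colour≢'
    ; ≤2-T           = ≤2-T'
    }
    where
    covers' : ∀ i → InOneBag Bag' (ends G' i)
    covers' i with covers (old-edge i)
    ... | y , y∋p , y∋q =
      subst (InOneBag Bag') (sym (ends-image i)) (image-covers (Merged-covers y∋p y∋q))

    shared⇒T' : ∀ {y z b} → y ≢ z → Bag' y b → Bag' z b → InT G' b
    shared⇒T' y≢z y∋b z∋b with common-preimage y≢z y∋b z∋b
    ... | a , y∋a , z∋a , (a≢u , a≢v) , refl =
      trans (T-off a a≢u a≢v) (proj₁ (Merged-shared y≢z y∋a z∋a))

    shared⇒colour≢' : ∀ {y z b} → y ≢ z → Bag' y b → Bag' z b → colour' y ≢ colour' z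
    shared⇒colour≢' y≢z y∋b z∋b with common-preimage y≢z y∋b z∋b
    ... | a , y∋a , z∋a , _ = proj₂ (Merged-shared y≢z y∋a z∋a)

    ≤2-T' : ∀ {y b₁ b₂ b₃} → Distinct₃ b₁ b₂ b₃ → Bag' y b₁ → Bag' y b₂ → Bag' y b₃ →
            InT G' b₁ → InT G' b₂ → InT G' b₃ → ⊥
    ≤2-T' d h₁ h₂ h₃ t₁ t₂ t₃ with lift-T h₁ t₁ | lift-T h₂ t₂ | lift-T h₃ t₃
    ... | _ , l₁ , refl | _ , l₂ , refl | _ , l₃ , refl =
      Merged-≤2-T (Distinct₃-unmap f d) l₁ l₂ l₃

cover-contraction : ∀ {n m n' m'} {G : Graft n m} {G' : Graft n' m'} (c : Cover G) {u v} →
  Contraction G G' u v → u ≢ v → InOneBag (Cover.Bag c) (u , v) → Cover G'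
cover-contraction {G = G} c {u} {v} κ u≢v (x , x∋u , x∋v)
  with lookup (T G) u in u∈? | lookup (T G) v in v∈?
... | _     | false = ContractNonTEnd.cover c κ v∈? x∋u x∋v
... | false | true  = ContractNonTEnd.cover c (Contraction-swap κ) u∈? x∋v x∋u
... | true  | true  = ContractTEdge.cover c κ u≢v u∈? v∈? x∋u x∋v

cover-step : ∀ {n m n' m'} {G : Graft n m} {G' : Graft n' m'} → Step G G' → Cover G → Cover G'
cover-step (del-edge _ _ e ends≡ T≡) c = cover-spanning-subgraph (punchIn e) ends≡ T≡ c
cover-step (contract-loop _ _ e _ ends≡ T≡) c = cover-spanning-subgraph (punchIn e) ends≡ T≡ c
cover-step (del-vertex _ _ v ends≡ T≡) c =
  pullback c (punchIn v) (punchIn-injective v _ _) T≡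
    (λ i → subst (InOneBag (Cover.Bag c)) (ends≡ i) (Cover.covers c i))
cover-step {G = G} {G'} (contract _ _ e f u≢v fu≡fv f-fibres f-onto ends≡ T-off T-merged) c =
  cover-contraction c κ u≢v (Cover.covers c e)
  where
  κ : Contraction G G' (proj₁ (ends G e)) (proj₂ (ends G e))
  κ = record
    { f             = f
    ; merges        = fu≡fv
    ; injective-off = injective-off
    ; surjective    = f-onto
    ; old-edge      = punchIn e
    ; ends-image    = ends≡
    ; T-off         = T-off
    ; T-merged      = T-merged
    }
    where
    injective-off : ∀ {a b} → a ≢ proj₁ (ends G e) → a ≢ proj₂ (ends G e) → f b ≡ f a → b ≡ a
    injective-off {a} {b} a≢u a≢v fb≡fa with f-fibres b a fb≡fa
    ... | inj₁ b≡a             = b≡a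
    ... | inj₂ (inj₁ (_ , a≡v)) = ⊥-elim (a≢v a≡v)
    ... | inj₂ (inj₂ (_ , a≡u)) = ⊥-elim (a≢u a≡u)

cover-minor : ∀ {n m n' m'} {G : Graft n m} {G' : Graft n' m'} → Minor G G' → Cover G → Cover G'
cover-minor (here _)         c = c
cover-minor (next step rest) c = cover-minor rest (cover-step step c)

uncoverable⇒excluded-minor : ∀ {n m n' m'} {G : Graft n m} {Δ : Graft n' m'} →
  Cover G → ¬ Cover Δ → ¬ HasMinorIsoTo G Δ
uncoverable⇒excluded-minor c Δ-uncoverable (_ , _ , H , G≽H , H≅Δ) =
  Δ-uncoverable (cover-iso H≅Δ (cover-minor G≽H c))

lemma3p12 : ∀ {n m} (G : Graft n m) → CyclicDecomposition G →
    ¬ HasMinorIsoTo G Δ₁ × ¬ HasMinorIsoTo G Δ₂ × ¬ HasMinorIsoTo G Δ₃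
lemma3p12 G cd =
    uncoverable⇒excluded-minor c Δ₁-uncoverable
  , uncoverable⇒excluded-minor c Δ₂-uncoverable
  , uncoverable⇒excluded-minor c Δ₃-uncoverable
  where c = decomposition⇒cover cd
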